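{- If $S$ is an admissible pinnacle set, then for every positive integer $x$ the set $S_x = [1,x]\cap S$ is an admissible pinnacle set.
   Context: A permutation $w = w(1)\cdots w(n)$ of $[n]$ has a pinnacle $w(i)$ whenever $i\in[2,n-1]$ and $w(i-1) < w(i) > w(i+1)$. A set $S$ of positive integers is an admissible pinnacle set if there exists a permutation whose set of pinnacles is exactly $S$. -}

module Defs where

open import Data.Nat using (ℕ; suc; _<_; _≤_; _+_)
open import Data.Fin using (Fin; toℕ)
open import Data.Fin.Permutation using (Permutation; _⟨$⟩ʳ_)
open import Data.Product using (∃-syntax; _×_)
open import Relation.Binary.PropositionalEquality using (_≡_)
open import Function.Bundles using (_⇔_)

-- Position p : Fin n stands for the 1-based position toℕ p + 1, and the
-- value at that position is  w(p) = toℕ (w p) + 1 ∈ [n].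
val : ∀ {n} → Permutation n n → Fin n → ℕ
val w p = suc (toℕ (w ⟨$⟩ʳ p))

IsPinnacle : ∀ {n} → Permutation n n → ℕ → Set
IsPinnacle {n} w m =
  ∃[ a ] ∃[ b ] ∃[ c ]
    (suc (toℕ a) ≡ toℕ b) × (suc (toℕ b) ≡ toℕ c) ×
    (val w a < val w b) × (val w c < val w b) × (val w b ≡ m)

PinnacleSetIs : ∀ {n} → Permutation n n → (ℕ → Set) → Set
PinnacleSetIs w S = ∀ m → (S m ⇔ IsPinnacle w m)

Admissible : (ℕ → Set) → Set
Admissible S = ∃[ n ] ∃[ w ] PinnacleSetIs {n} w S

_∩[1,_] : (ℕ → Set) → ℕ → (ℕ → Set)
(S ∩[1, x ]) m = (1 ≤ m) × (m ≤ x) × S m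

-- Keep from the word of w only the triples a < b > c around the pinnacles b ≤ x,
-- in their original order (two such triples may share an end), and append all
-- remaining letters in increasing order. Every junction then joins a letter that
-- is smaller than its left neighbour to one that is smaller than its right
-- neighbour, and the increasing tail has no pinnacle, so the rearranged word has
-- exactly the pinnacles of w that are at most x.
module Submission where

open import Defs
open import Data.Nat.Base using (ℕ; zero; suc; _≤_; _<_; z≤n; s≤s)
open import Data.Nat.Properties using (_<?_; _≤?_; <-asym; <-trans; suc-injective; ≤-antisym; ≤-reflexive)
open import Data.Fin.Base as Fin using (Fin; toℕ; cast; inject₁)
open import Data.Fin.Properties using (_≟_; toℕ-inject₁; injective⇒≤; cast-involutive)
open import Data.Fin.Permutation using (Permutation; _⟨$⟩ʳ_; permutation)
open import Data.List.Base using (List; []; _∷_; _++_; tabulate; allFin; filter; length; lookup)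
open import Data.List.Relation.Unary.Linked using (Linked; []; [-]; _∷_)
import Data.List.Relation.Unary.Linked.Properties as Linked
import Data.List.Relation.Unary.All as All
open import Data.List.Relation.Unary.AllPairs using ([]; _∷_)
import Data.List.Relation.Unary.Any as Any
open import Data.List.Relation.Unary.Any.Properties using (lookup-index)
open import Data.List.Relation.Unary.Unique.Propositional using (Unique)
import Data.List.Relation.Unary.Unique.Propositional.Properties as Unique
open import Data.List.Relation.Binary.Sublist.Propositional using (_⊆_; []; _∷_; _∷ʳ_)
open import Data.List.Relation.Binary.Sublist.Propositional.Properties using (All-resp-⊆)
open import Data.List.Membership.Propositional using (_∈_)
open import Data.List.Membership.Propositional.Properties using (∈-filter⁺; ∈-filter⁻; ∈-allFin; ∈-++⁺ˡ; ∈-++⁺ʳ; ∈-lookup)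
import Data.List.Membership.DecPropositional as DecMembership
open import Data.Product as Product using (_×_; _,_; proj₁; proj₂; ∃-syntax)
open import Data.Unit using (⊤; tt)
open import Data.Empty using (⊥-elim)
open import Relation.Nullary using (Dec; yes; no; ¬_; ¬?)
open import Relation.Nullary.Decidable using (_×-dec_)
open import Relation.Binary.PropositionalEquality using (_≡_; refl; sym; trans; cong; subst)
open import Function.Base using (_∘_; id)
open import Function.Bundles using (_⇔_; mk⇔; Equivalence; Injection)
open import Function.Properties.Inverse using (Inverse⇒Injection)
open import Function.Properties.Equivalence using (⇔-setoid) renaming (refl to ⇔-refl; sym to ⇔-sym)
open import Data.Product.Function.NonDependent.Propositional using (_×-⇔_)
open import Level using (0ℓ)
import Relation.Binary.Reasoning.Setoid as SetoidReasoning

module EquivalenceReasoning = SetoidReasoning (⇔-setoid 0ℓ)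

module Words {A : Set} (rank : A → ℕ) where

  Peak : A → A → A → Set
  Peak a b c = rank a < rank b × rank c < rank b

  data Pinnacle : List A → ℕ → Set where
    here  : ∀ {a b c r m} → Peak a b c → rank b ≡ m → Pinnacle (a ∷ b ∷ c ∷ r) m
    there : ∀ {a l m} → Pinnacle l m → Pinnacle (a ∷ l) m

  Pinnacleᶠ : ∀ {N} → (Fin N → A) → ℕ → Set
  Pinnacleᶠ f m = ∃[ a ] ∃[ b ] ∃[ c ]
    (suc (toℕ a) ≡ toℕ b) × (suc (toℕ b) ≡ toℕ c) ×
    (rank (f a) < rank (f b)) × (rank (f c) < rank (f b)) × (rank (f b) ≡ m)

  Pinnacleᶠ⇒Pinnacle-tabulate : ∀ {N} (f : Fin N → A) {m} → Pinnacleᶠ f m → Pinnacle (tabulate f) m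
  Pinnacleᶠ⇒Pinnacle-tabulate f
    (Fin.zero , Fin.suc Fin.zero , Fin.suc (Fin.suc Fin.zero) , refl , refl , a<b , c<b , b≡m) =
    here (a<b , c<b) b≡m
  Pinnacleᶠ⇒Pinnacle-tabulate f (Fin.zero , Fin.zero , _ , () , _)
  Pinnacleᶠ⇒Pinnacle-tabulate f (Fin.zero , Fin.suc (Fin.suc _) , _ , () , _)
  Pinnacleᶠ⇒Pinnacle-tabulate f (Fin.zero , Fin.suc Fin.zero , Fin.zero , refl , () , _)
  Pinnacleᶠ⇒Pinnacle-tabulate f (Fin.zero , Fin.suc Fin.zero , Fin.suc Fin.zero , refl , () , _)
  Pinnacleᶠ⇒Pinnacle-tabulate f (Fin.zero , Fin.suc Fin.zero , Fin.suc (Fin.suc (Fin.suc _)) , _ , () , _)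
  Pinnacleᶠ⇒Pinnacle-tabulate f (Fin.suc _ , Fin.zero , _ , () , _)
  Pinnacleᶠ⇒Pinnacle-tabulate f (Fin.suc _ , Fin.suc _ , Fin.zero , _ , () , _)
  Pinnacleᶠ⇒Pinnacle-tabulate f (Fin.suc a , Fin.suc b , Fin.suc c , a+1≡b , b+1≡c , peak) =
    there (Pinnacleᶠ⇒Pinnacle-tabulate (f ∘ Fin.suc) (a , b , c , suc-injective a+1≡b , suc-injective b+1≡c , peak))

  Pinnacle-tabulate⇒Pinnacleᶠ : ∀ {N} (f : Fin N → A) {m} → Pinnacle (tabulate f) m → Pinnacleᶠ f m
  Pinnacle-tabulate⇒Pinnacleᶠ {suc (suc (suc _))} f (here (a<b , c<b) b≡m) =
    Fin.zero , Fin.suc Fin.zero , Fin.suc (Fin.suc Fin.zero) , refl , refl , a<b , c<b , b≡m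
  Pinnacle-tabulate⇒Pinnacleᶠ {suc _} f (there p) with Pinnacle-tabulate⇒Pinnacleᶠ (f ∘ Fin.suc) p
  ... | a , b , c , a+1≡b , b+1≡c , peak =
    Fin.suc a , Fin.suc b , Fin.suc c , cong suc a+1≡b , cong suc b+1≡c , peak

  Pinnacleᶠ⇔Pinnacle-tabulate : ∀ {N} (f : Fin N → A) {m} → Pinnacleᶠ f m ⇔ Pinnacle (tabulate f) m
  Pinnacleᶠ⇔Pinnacle-tabulate f = mk⇔ (Pinnacleᶠ⇒Pinnacle-tabulate f) (Pinnacle-tabulate⇒Pinnacleᶠ f)

  Ascending : List A → Set
  Ascending = Linked (λ a b → rank a < rank b)

  StartsAscending : List A → Set
  StartsAscending (a ∷ b ∷ _) = rank a < rank b
  StartsAscending _           = ⊤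

  tabulate-ascending : ∀ {N} (f : Fin (suc N) → A) →
    (∀ i → rank (f (inject₁ i)) < rank (f (Fin.suc i))) → Ascending (tabulate f)
  tabulate-ascending {zero} f _ = [-]
  tabulate-ascending {suc _} f step = step Fin.zero ∷ tabulate-ascending (f ∘ Fin.suc) (step ∘ Fin.suc)

  ascending⇒startsAscending : ∀ {l} → Ascending l → StartsAscending l
  ascending⇒startsAscending []        = tt
  ascending⇒startsAscending [-]       = tt
  ascending⇒startsAscending (a<b ∷ _) = a<b

  ascending⇒¬Pinnacle : ∀ {l m} → Ascending l → ¬ Pinnacle l m
  ascending⇒¬Pinnacle (_ ∷ b<c ∷ _) (here (_ , c<b) _) = <-asym b<c c<b
  ascending⇒¬Pinnacle (_ ∷ asc)     (there p)          = ascending⇒¬Pinnacle asc p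
  ascending⇒¬Pinnacle [-]           (there ())

  Pinnacle-tail-ascent : ∀ {a l m} → StartsAscending l → Pinnacle (a ∷ l) m → Pinnacle l m
  Pinnacle-tail-ascent b<c (here (_ , c<b) _) = ⊥-elim (<-asym b<c c<b)
  Pinnacle-tail-ascent _   (there p)          = p

  Pinnacle-tail-descent : ∀ {b c r m} → rank c < rank b → Pinnacle (b ∷ c ∷ r) m → Pinnacle (c ∷ r) m
  Pinnacle-tail-descent c<b (here (b<c , _) _) = ⊥-elim (<-asym c<b b<c)
  Pinnacle-tail-descent _   (there p)          = p

  module Prune (x : ℕ) where

    SmallPeak : A → A → A → Set
    SmallPeak a b c = Peak a b c × rank b ≤ x

    smallPeak? : ∀ a b c → Dec (SmallPeak a b c)
    smallPeak? a b c = ((rank a <? rank b) ×-dec (rank c <? rank b)) ×-dec (rank b ≤? x)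

    SmallPinnacle : List A → ℕ → Set
    SmallPinnacle l m = Pinnacle l m × m ≤ x

    -- pruneWindow a b r prunes a ∷ b ∷ r; keepAfter c r continues the pruning
    -- of c ∷ r when c, the right end of a kept small peak, is already emitted.
    mutual
      pruneWindow : A → A → List A → List A
      pruneWindow a b (c ∷ r) with smallPeak? a b c
      ... | yes _ = a ∷ b ∷ c ∷ keepAfter c r
      ... | no  _ = pruneWindow b c r
      pruneWindow a b [] = []

      keepAfter : A → List A → List A
      keepAfter c (d ∷ e ∷ r) with smallPeak? c d e
      ... | yes _ = d ∷ e ∷ keepAfter e r
      ... | no  _ = pruneWindow d e r
      keepAfter c _ = []

    prune : List A → List A
    prune (a ∷ b ∷ r) = pruneWindow a b r
    prune _           = []

    mutual
      pruneWindow-⊆ : ∀ a b r → pruneWindow a b r ⊆ a ∷ b ∷ r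
      pruneWindow-⊆ a b (c ∷ r) with smallPeak? a b c
      ... | yes _ = refl ∷ refl ∷ keepAfter-⊆ c r
      ... | no  _ = a ∷ʳ pruneWindow-⊆ b c r
      pruneWindow-⊆ a b [] = a ∷ʳ b ∷ʳ []

      keepAfter-⊆ : ∀ c r → c ∷ keepAfter c r ⊆ c ∷ r
      keepAfter-⊆ c (d ∷ e ∷ r) with smallPeak? c d e
      ... | yes _ = refl ∷ refl ∷ keepAfter-⊆ e r
      ... | no  _ = refl ∷ pruneWindow-⊆ d e r
      keepAfter-⊆ c []       = refl ∷ []
      keepAfter-⊆ c (d ∷ []) = refl ∷ d ∷ʳ []

    prune-⊆ : ∀ l → prune l ⊆ l
    prune-⊆ (a ∷ b ∷ r) = pruneWindow-⊆ a b r
    prune-⊆ []          = []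
    prune-⊆ (a ∷ [])    = a ∷ʳ []

    module _ {T : List A} (T-ascending : Ascending T) where

      pruneWindow++-startsAscending : ∀ a b r → StartsAscending (pruneWindow a b r ++ T)
      pruneWindow++-startsAscending a b (c ∷ r) with smallPeak? a b c
      ... | yes ((a<b , _) , _) = a<b
      ... | no  _               = pruneWindow++-startsAscending b c r
      pruneWindow++-startsAscending a b [] = ascending⇒startsAscending T-ascending

      ¬Pinnacle-∷-tail : ∀ {c m} → ¬ Pinnacle (c ∷ T) m
      ¬Pinnacle-∷-tail =
        ascending⇒¬Pinnacle T-ascending ∘ Pinnacle-tail-ascent (ascending⇒startsAscending T-ascending)

      mutual
        pruneWindow-pinnacle⁻ : ∀ a b r {m} →
          Pinnacle (pruneWindow a b r ++ T) m → SmallPinnacle (a ∷ b ∷ r) m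
        pruneWindow-pinnacle⁻ a b (c ∷ r) p with smallPeak? a b c
        pruneWindow-pinnacle⁻ a b (c ∷ r) (here _ b≡m) | yes (peak , b≤x) =
          here peak b≡m , subst (_≤ x) b≡m b≤x
        pruneWindow-pinnacle⁻ a b (c ∷ r) (there p)    | yes ((_ , c<b) , _) =
          Product.map₁ (there ∘ there) (keepAfter-pinnacle⁻ c r (Pinnacle-tail-descent c<b p))
        ... | no _ = Product.map₁ there (pruneWindow-pinnacle⁻ b c r p)
        pruneWindow-pinnacle⁻ a b [] p = ⊥-elim (ascending⇒¬Pinnacle T-ascending p)

        keepAfter-pinnacle⁻ : ∀ c r {m} → Pinnacle (c ∷ keepAfter c r ++ T) m → SmallPinnacle (c ∷ r) m
        keepAfter-pinnacle⁻ c (d ∷ e ∷ r) p with smallPeak? c d e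
        keepAfter-pinnacle⁻ c (d ∷ e ∷ r) (here _ d≡m) | yes (peak , d≤x) =
          here peak d≡m , subst (_≤ x) d≡m d≤x
        keepAfter-pinnacle⁻ c (d ∷ e ∷ r) (there p)    | yes ((_ , e<d) , _) =
          Product.map₁ (there ∘ there) (keepAfter-pinnacle⁻ e r (Pinnacle-tail-descent e<d p))
        ... | no _ = Product.map₁ there
          (pruneWindow-pinnacle⁻ d e r (Pinnacle-tail-ascent (pruneWindow++-startsAscending d e r) p))
        keepAfter-pinnacle⁻ c []       p = ⊥-elim (¬Pinnacle-∷-tail p)
        keepAfter-pinnacle⁻ c (_ ∷ []) p = ⊥-elim (¬Pinnacle-∷-tail p)

      mutual
        pruneWindow-pinnacle⁺ : ∀ a b r {m} →
          SmallPinnacle (a ∷ b ∷ r) m → Pinnacle (pruneWindow a b r ++ T) m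
        pruneWindow-pinnacle⁺ a b (c ∷ r) p with smallPeak? a b c
        pruneWindow-pinnacle⁺ a b (c ∷ r) (here peak b≡m , _) | yes _ = here peak b≡m
        pruneWindow-pinnacle⁺ a b (c ∷ r) (there (here (b<c , _) _) , _) | yes ((_ , c<b) , _) =
          ⊥-elim (<-asym b<c c<b)
        pruneWindow-pinnacle⁺ a b (c ∷ r) (there (there p) , m≤x) | yes _ =
          there (there (keepAfter-pinnacle⁺ c r (p , m≤x)))
        pruneWindow-pinnacle⁺ a b (c ∷ r) (here peak b≡m , m≤x) | no ¬small =
          ⊥-elim (¬small (peak , subst (_≤ x) (sym b≡m) m≤x))
        pruneWindow-pinnacle⁺ a b (c ∷ r) (there p , m≤x) | no _ = pruneWindow-pinnacle⁺ b c r (p , m≤x)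
        pruneWindow-pinnacle⁺ a b [] (there (there ()) , _)

        keepAfter-pinnacle⁺ : ∀ c r {m} → SmallPinnacle (c ∷ r) m → Pinnacle (c ∷ keepAfter c r ++ T) m
        keepAfter-pinnacle⁺ c (d ∷ e ∷ r) p with smallPeak? c d e
        keepAfter-pinnacle⁺ c (d ∷ e ∷ r) (here peak d≡m , _) | yes _ = here peak d≡m
        keepAfter-pinnacle⁺ c (d ∷ e ∷ r) (there (here (d<e , _) _) , _) | yes ((_ , e<d) , _) =
          ⊥-elim (<-asym d<e e<d)
        keepAfter-pinnacle⁺ c (d ∷ e ∷ r) (there (there p) , m≤x) | yes _ =
          there (there (keepAfter-pinnacle⁺ e r (p , m≤x)))
        keepAfter-pinnacle⁺ c (d ∷ e ∷ r) (here peak d≡m , m≤x) | no ¬small =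
          ⊥-elim (¬small (peak , subst (_≤ x) (sym d≡m) m≤x))
        keepAfter-pinnacle⁺ c (d ∷ e ∷ r) (there p , m≤x) | no _ = there (pruneWindow-pinnacle⁺ d e r (p , m≤x))
        keepAfter-pinnacle⁺ c []       (there () , _)
        keepAfter-pinnacle⁺ c (_ ∷ []) (there (there ()) , _)

      prune-pinnacle : ∀ l {m} → Pinnacle (prune l ++ T) m ⇔ SmallPinnacle l m
      prune-pinnacle (a ∷ b ∷ r) = mk⇔ (pruneWindow-pinnacle⁻ a b r) (pruneWindow-pinnacle⁺ a b r)
      prune-pinnacle []          = mk⇔ (⊥-elim ∘ ascending⇒¬Pinnacle T-ascending) λ ()
      prune-pinnacle (a ∷ [])    = mk⇔ (⊥-elim ∘ ascending⇒¬Pinnacle T-ascending) λ { (there () , _) }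

Unique-resp-⊆ : ∀ {B : Set} {xs ys : List B} → xs ⊆ ys → Unique ys → Unique xs
Unique-resp-⊆ []         []           = []
Unique-resp-⊆ (_ ∷ʳ xs⊆ys) (_ ∷ ys!)    = Unique-resp-⊆ xs⊆ys ys!
Unique-resp-⊆ (refl ∷ xs⊆ys) (y∉ys ∷ ys!) = All-resp-⊆ xs⊆ys y∉ys ∷ Unique-resp-⊆ xs⊆ys ys!

lookup-injective : ∀ {B : Set} {xs : List B} → Unique xs → ∀ {i j} → lookup xs i ≡ lookup xs j → i ≡ j
lookup-injective {xs = _ ∷ _} (_ ∷ _)  {Fin.zero}  {Fin.zero}  _  = refl
lookup-injective {xs = _ ∷ _} (x∉ ∷ _) {Fin.zero}  {Fin.suc j} eq = ⊥-elim (All.lookup x∉ (∈-lookup j) eq)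
lookup-injective {xs = _ ∷ _} (x∉ ∷ _) {Fin.suc i} {Fin.zero}  eq = ⊥-elim (All.lookup x∉ (∈-lookup i) (sym eq))
lookup-injective {xs = _ ∷ _} (_ ∷ xs!) {Fin.suc i} {Fin.suc j} eq = cong Fin.suc (lookup-injective xs! eq)

tabulate-lookup-cast : ∀ {B : Set} (xs : List B) {N} (eq : N ≡ length xs) → tabulate (lookup xs ∘ cast eq) ≡ xs
tabulate-lookup-cast []       refl = refl
tabulate-lookup-cast (x ∷ xs) refl = cong (x ∷_) (tabulate-lookup-cast xs refl)

valueRank : ∀ {n} → Fin n → ℕ
valueRank v = suc (toℕ v)

allFin-ascending : ∀ n → Words.Ascending valueRank (allFin n)
allFin-ascending zero = []
allFin-ascending (suc _) = Words.tabulate-ascending valueRank id λ i → s≤s (s≤s (≤-reflexive (toℕ-inject₁ i)))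

module _ {n : ℕ} where

  open Words (valueRank {n})

  isPinnacle⇔Pinnacle : ∀ (w : Permutation n n) {m} → IsPinnacle w m ⇔ Pinnacle (tabulate (w ⟨$⟩ʳ_)) m
  isPinnacle⇔Pinnacle w = Pinnacleᶠ⇔Pinnacle-tabulate (w ⟨$⟩ʳ_)

  isPinnacle⇒positive : ∀ (w : Permutation n n) {m} → IsPinnacle w m → 1 ≤ m
  isPinnacle⇒positive _ (_ , _ , _ , _ , _ , _ , _ , b≡m) = subst (1 ≤_) b≡m (s≤s z≤n)

  word-unique : ∀ (w : Permutation n n) → Unique (tabulate (w ⟨$⟩ʳ_))
  word-unique w = Unique.tabulate⁺ (Injection.injective (Inverse⇒Injection w))

  module _ (xs : List (Fin n)) (xs! : Unique xs) (complete : ∀ v → v ∈ xs) where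

    private
      index : Fin n → Fin (length xs)
      index v = Any.index (complete v)

      index-injective : ∀ {u v} → index u ≡ index v → u ≡ v
      index-injective {u} {v} eq =
        trans (lookup-index (complete u)) (trans (cong (lookup xs) eq) (sym (lookup-index (complete v))))

      n≡length : n ≡ length xs
      n≡length = ≤-antisym (injective⇒≤ index-injective) (injective⇒≤ (lookup-injective xs!))

      σ : Fin n → Fin n
      σ = lookup xs ∘ cast n≡length

      σ⁻¹ : Fin n → Fin n
      σ⁻¹ = cast (sym n≡length) ∘ index

      σ∘σ⁻¹ : ∀ v → σ (σ⁻¹ v) ≡ v
      σ∘σ⁻¹ v = trans (cong (lookup xs) (cast-involutive n≡length (sym n≡length) (index v)))
                      (sym (lookup-index (complete v)))

      σ-injective : ∀ {p q} → σ p ≡ σ q → p ≡ q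
      σ-injective {p} {q} eq =
        trans (sym (cast-involutive (sym n≡length) n≡length p))
              (trans (cong (cast (sym n≡length)) (lookup-injective xs! eq))
                     (cast-involutive (sym n≡length) n≡length q))

    enumeration⇒permutation : ∃[ w ] tabulate (w ⟨$⟩ʳ_) ≡ xs
    enumeration⇒permutation =
      permutation σ σ⁻¹ σ∘σ⁻¹ (λ p → σ-injective (σ∘σ⁻¹ (σ p))) , tabulate-lookup-cast xs n≡length

  open DecMembership (_≟_ {n}) using (_∈?_)

  missing : List (Fin n) → List (Fin n)
  missing xs = filter (λ v → ¬? (v ∈? xs)) (allFin n)

  missing-ascending : ∀ xs → Ascending (missing xs)
  missing-ascending xs = Linked.filter⁺ _ <-trans (allFin-ascending n)

  ++-missing-complete : ∀ xs v → v ∈ xs ++ missing xs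
  ++-missing-complete xs v with v ∈? xs
  ... | yes v∈xs = ∈-++⁺ˡ v∈xs
  ... | no  v∉xs = ∈-++⁺ʳ xs (∈-filter⁺ _ (∈-allFin v) v∉xs)

  ++-missing-unique : ∀ {xs} → Unique xs → Unique (xs ++ missing xs)
  ++-missing-unique {xs} xs! = Unique.++⁺ xs! (Unique.filter⁺ _ (Unique.allFin⁺ n))
    λ (v∈xs , v∈missing) → proj₂ (∈-filter⁻ _ {xs = allFin n} v∈missing) v∈xs

  pinnacles-restrict : ∀ (w : Permutation n n) x →
    ∃[ w′ ] ∀ m → IsPinnacle w′ m ⇔ (IsPinnacle w m × m ≤ x)
  pinnacles-restrict w x = w′ , λ m → begin
    IsPinnacle w′ m                    ≈⟨ isPinnacle⇔Pinnacle w′ ⟩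
    Pinnacle (tabulate (w′ ⟨$⟩ʳ_)) m   ≡⟨ cong (λ l → Pinnacle l m) w′-word ⟩
    Pinnacle (kept ++ missing kept) m  ≈⟨ prune-pinnacle (missing-ascending kept) word ⟩
    (Pinnacle word m × m ≤ x)          ≈⟨ ⇔-sym (isPinnacle⇔Pinnacle w) ×-⇔ ⇔-refl ⟩
    (IsPinnacle w m × m ≤ x)           ∎
    where
    open Prune x
    open EquivalenceReasoning

    word : List (Fin n)
    word = tabulate (w ⟨$⟩ʳ_)

    kept : List (Fin n)
    kept = prune word

    rearranged : ∃[ w′ ] tabulate (w′ ⟨$⟩ʳ_) ≡ kept ++ missing kept
    rearranged = enumeration⇒permutation (kept ++ missing kept)
      (++-missing-unique (Unique-resp-⊆ (prune-⊆ word) (word-unique w))) (++-missing-complete kept)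

    w′ : Permutation n n
    w′ = proj₁ rearranged

    w′-word : tabulate (w′ ⟨$⟩ʳ_) ≡ kept ++ missing kept
    w′-word = proj₂ rearranged

corollary3p5 : (S : ℕ → Set) → Admissible S →
    (x : ℕ) → 1 ≤ x → Admissible (S ∩[1, x ])
corollary3p5 S (n , w , S⇔pinnacle) x _ with pinnacles-restrict w x
... | w′ , restrict = n , w′ , λ m → mk⇔
  (λ (_ , m≤x , m∈S) → from (restrict m) (to (S⇔pinnacle m) m∈S , m≤x))
  (λ p → let pw , m≤x = to (restrict m) p in isPinnacle⇒positive w′ p , m≤x , from (S⇔pinnacle m) pw)
  where open Equivalence
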